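{- Let $\{(A_i,\cdot)\mid i<\omega\}$ be a family of finite Steiner quasigroups such that $|A_i|\geq 3$ for at least one $i<\omega$. Then there is a countably infinite Steiner quasigroup $(M,\cdot)$ such that: (1) $M$ is generated by three elements; (2) every $(A_i,\cdot)$ embeds in $(M,\cdot)$; (3) if a finite Steiner quasigroup embeds in $(M,\cdot)$, it embeds in some $(A_i,\cdot)$.
   Context: A Steiner quasigroup is a structure $(A,\cdot)$ with a binary operation satisfying $a\cdot b=b\cdot a$, $a\cdot a=a$, $a\cdot(a\cdot b)=b$. Embeddings and generation are in the sense of the language $\{\cdot\}$. -}

module Defs where

open import Data.Nat using (ℕ; _≤_)
open import Data.Fin using (Fin)
open import Data.Product using (Σ; ∃; _×_; _,_; proj₁)
open import Function.Bundles using (_↔_)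
open import Function.Definitions using (Injective)
open import Relation.Binary.PropositionalEquality using (_≡_)

record SteinerQuasigroup : Set₁ where
  infixl 7 _·_
  field
    Carrier : Set
    _·_     : Carrier → Carrier → Carrier
    comm    : ∀ a b → a · b ≡ b · a
    idem    : ∀ a → a · a ≡ a
    absorb  : ∀ a b → a · (a · b) ≡ b

open SteinerQuasigroup public

Finite : SteinerQuasigroup → Set
Finite A = Σ ℕ λ n → Carrier A ↔ Fin n

card : (A : SteinerQuasigroup) → Finite A → ℕ
card A fin = proj₁ fin

CountablyInfinite : SteinerQuasigroup → Set
CountablyInfinite M = Carrier M ↔ ℕ

record Embedding (A B : SteinerQuasigroup) : Set where
  field
    map      : Carrier A → Carrier B
    injective : Injective _≡_ _≡_ map
    hom      : ∀ x y → map (_·_ A x y) ≡ _·_ B (map x) (map y)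

data Generated (M : SteinerQuasigroup) (a b c : Carrier M) : Carrier M → Set where
  gen-a : Generated M a b c a
  gen-b : Generated M a b c b
  gen-c : Generated M a b c c
  gen-· : ∀ {x y} → Generated M a b c x → Generated M a b c y
        → Generated M a b c (_·_ M x y)

ThreeGenerated : SteinerQuasigroup → Set
ThreeGenerated M = Σ (Carrier M) λ a → Σ (Carrier M) λ b → Σ (Carrier M) λ c →
  ∀ x → Generated M a b c x

module Submission where

-- M is the free completion of a partial Steiner triple system: its points are the elements
-- of all A i (with the lines of A i), two generators g₁ g₂, and links arranged in chains.
-- Lines through g₁ and g₂ zigzag along each chain, so g₁, g₂ and the first link of the
-- trunk generate every link; level i of the trunk sprouts branch i, and level k of branch i
-- produces the element of A i with index k.  The completion adds a new point for each pair
-- not yet on a line.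

open import Defs
open import Data.Nat using (ℕ; _≤_)
open import Data.Product using (Σ; ∃; _×_)
open import Data.Product using (_,_; proj₁; proj₂)
open import Data.List using (List)
open import Data.Maybe using (Maybe; just; nothing)
open import Relation.Binary.PropositionalEquality using (_≡_; _≢_; refl; sym; trans)

module Enumeration where

  open import Data.Nat using (zero; suc; _+_; _<_; _⊔_; s≤s; _≤′_; ≤′-refl; ≤′-step)
  open import Data.Nat.Properties
    using (+-suc; +-identityʳ; ≤-refl; <-cmp; m≤n⇒m<n∨m≡n; m≤m⊔n; m≤n⊔m; ≤⇒≤′)
  open import Data.Fin using (Fin; toℕ)
  open import Data.Fin.Properties using (pigeonhole; toℕ-injective; all?; ¬∀⟶∃¬; <-irrefl)
  open import Data.List using (List; []; _∷_; _++_; length; lookup; cartesianProductWith)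
  open import Data.List.Relation.Unary.Any using (here; there; index)
  open import Data.List.Relation.Unary.Any.Properties using (lookup-index)
  open import Data.List.Membership.Propositional using (_∈_; _∉_)
  open import Data.List.Membership.Propositional.Properties using (∈-++⁺ˡ; ∈-++⁺ʳ; ∈-cartesianProductWith⁺)
  import Data.List.Membership.DecPropositional as DecMembership
  open import Data.Product using (_,_; proj₁; proj₂)
  open import Data.Sum using (inj₁; inj₂)
  open import Data.Empty using (⊥-elim)
  open import Relation.Nullary using (yes; no)
  open import Relation.Binary using (DecidableEquality; tri<; tri≈; tri>)
  open import Relation.Binary.PropositionalEquality using (_≡_; _≢_; refl; sym; trans; cong; subst; module ≡-Reasoning)
  open import Function.Bundles using (_↔_; mk↔ₛ′)
  open import Function.Definitions using (Injective)

  Enumerates : {X : Set} → (ℕ → X) → Set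
  Enumerates s = ∀ x → ∃ λ n → s n ≡ x

  -- Cantor's diagonal walk through ℕ × ℕ:  (0,0), (0,1), (1,0), (0,2), (1,1), (2,0), ...
  step : ℕ × ℕ → ℕ × ℕ
  step (a , zero) = 0 , suc a
  step (a , suc b) = suc a , b

  diagonal : ℕ → ℕ × ℕ
  diagonal zero = 0 , 0
  diagonal (suc n) = step (diagonal n)

  walk-along : ∀ a b → (∃ λ n → diagonal n ≡ (0 , a + b)) → ∃ λ n → diagonal n ≡ (a , b)
  walk-along zero b reached = reached
  walk-along (suc a) b (n , eq) with walk-along a (suc b) (n , trans eq (cong (0 ,_) (sym (+-suc a b))))
  ... | m , eq′ = suc m , cong step eq′

  -- ... and the start of every diagonal is reached, from the end (d , 0) of the previous one.
  walk-start : ∀ d → ∃ λ n → diagonal n ≡ (0 , d)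
  walk-start zero = 0 , refl
  walk-start (suc d) with walk-start d
  ... | n , eq with walk-along d 0 (n , trans eq (cong (0 ,_) (sym (+-identityʳ d))))
  ...   | m , eq′ = suc m , cong step eq′

  diagonal-enumerates : Enumerates diagonal
  diagonal-enumerates (a , b) = walk-along a b (walk-start (a + b))

  -- The bijection lists X without repetitions: at stage n
  -- it adds s n if that is new, and otherwise some value of f not listed so far.
  module _ {X : Set} (_≟_ : DecidableEquality X) {s : ℕ → X} (s-enum : Enumerates s)
           {f : ℕ → X} (f-inj : Injective _≡_ _≡_ f) where

    open DecMembership _≟_ using (_∈?_)

    -- Pigeonhole: f takes a value outside any finite list.
    escape : (L : List X) → ∃ λ j → f j ∉ L
    escape L with all? (λ (k : Fin (suc (length L))) → f (toℕ k) ∈? L)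
    ... | no ¬all = let (k , fk∉L) = ¬∀⟶∃¬ _ _ (λ k → f (toℕ k) ∈? L) ¬all in toℕ k , fk∉L
    ... | yes all = ⊥-elim (i≢j (toℕ-injective (f-inj (begin
            f (toℕ i)                  ≡⟨ lookup-index (all i) ⟩
            lookup L (index (all i))   ≡⟨ cong (lookup L) same-slot ⟩
            lookup L (index (all j))   ≡⟨ lookup-index (all j) ⟨
            f (toℕ j)                  ∎))))
      where
        open ≡-Reasoning
        collision = pigeonhole ≤-refl (λ k → index (all k))
        i = proj₁ collision
        j = proj₁ (proj₂ collision)
        same-slot = proj₂ (proj₂ (proj₂ collision))
        i≢j : i ≢ j
        i≢j i≡j = <-irrefl i≡j (proj₁ (proj₂ (proj₂ collision)))

    fresh : List X → ℕ → X
    fresh L n with s n ∈? L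
    ... | yes _ = f (proj₁ (escape L))
    ... | no _ = s n

    fresh∉ : ∀ L n → fresh L n ∉ L
    fresh∉ L n with s n ∈? L
    ... | yes _ = proj₂ (escape L)
    ... | no sn∉L = sn∉L

    listed : ℕ → List X
    listed zero = []
    listed (suc n) = fresh (listed n) n ∷ listed n

    element : ℕ → X
    element n = fresh (listed n) n

    element-listed : ∀ {i n} → i < n → element i ∈ listed n
    element-listed {n = suc n} i<1+n with m≤n⇒m<n∨m≡n i<1+n
    ... | inj₁ (s≤s i<n) = there (element-listed i<n)
    ... | inj₂ refl = here refl

    listed-element : ∀ {x} n → x ∈ listed n → ∃ λ i → element i ≡ x
    listed-element (suc n) (here refl) = n , refl
    listed-element (suc n) (there x∈) = listed-element n x∈

    s-listed : ∀ n → s n ∈ listed (suc n)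
    s-listed n with s n ∈? listed n
    ... | yes sn∈ = there sn∈
    ... | no _ = here refl

    -- each stage adds an element not listed before
    element-injective : Injective _≡_ _≡_ element
    element-injective {i} {j} eq with <-cmp i j
    ... | tri< i<j _ _ = ⊥-elim (fresh∉ (listed j) j (subst (_∈ listed j) eq (element-listed i<j)))
    ... | tri≈ _ i≡j _ = i≡j
    ... | tri> _ _ j<i = ⊥-elim (fresh∉ (listed i) i (subst (_∈ listed i) (sym eq) (element-listed j<i)))

    -- every x = s n is listed by stage n + 1
    position : ∀ x → ∃ λ i → element i ≡ x
    position x = let (n , sn≡x) = s-enum x in listed-element (suc n) (subst (_∈ listed (suc n)) sn≡x (s-listed n))

    countable : X ↔ ℕ
    countable = mk↔ₛ′ (λ x → proj₁ (position x)) element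
      (λ n → element-injective (proj₂ (position (element n))))
      (λ x → proj₂ (position x))

  -- A structure generated by three elements is enumerated by ℕ: list the elements obtained
  -- in at most m rounds of multiplication, and walk diagonally through (round , position).
  module _ (M : SteinerQuasigroup) (a b c : Carrier M) where

    rounds : ℕ → List (Carrier M)
    rounds zero = a ∷ b ∷ c ∷ []
    rounds (suc m) = rounds m ++ cartesianProductWith (_·_ M) (rounds m) (rounds m)

    rounds-mono : ∀ {x m n} → m ≤′ n → x ∈ rounds m → x ∈ rounds n
    rounds-mono ≤′-refl x∈ = x∈
    rounds-mono (≤′-step m≤′n) x∈ = ∈-++⁺ˡ (rounds-mono m≤′n x∈)

    generated-in-rounds : ∀ {x} → Generated M a b c x → ∃ λ m → x ∈ rounds m
    generated-in-rounds gen-a = 0 , here refl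
    generated-in-rounds gen-b = 0 , there (here refl)
    generated-in-rounds gen-c = 0 , there (there (here refl))
    generated-in-rounds (gen-· gx gy) with generated-in-rounds gx | generated-in-rounds gy
    ... | m , x∈ | n , y∈ = suc (m ⊔ n) , ∈-++⁺ʳ (rounds (m ⊔ n)) (∈-cartesianProductWith⁺ (_·_ M)
            (rounds-mono (≤⇒≤′ (m≤m⊔n m n)) x∈) (rounds-mono (≤⇒≤′ (m≤n⊔m m n)) y∈))

    -- the j-th entry of a list, or a past its end (so that every entry is some nth L j)
    nth : List (Carrier M) → ℕ → Carrier M
    nth [] _ = a
    nth (x ∷ L) zero = x
    nth (x ∷ L) (suc j) = nth L j

    nth-∈ : ∀ {x L} → x ∈ L → ∃ λ j → nth L j ≡ x
    nth-∈ (here refl) = 0 , refl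
    nth-∈ (there x∈) = let (j , eq) = nth-∈ x∈ in suc j , eq

  three-generated-enumerable : (M : SteinerQuasigroup) → ThreeGenerated M → Σ (ℕ → Carrier M) Enumerates
  three-generated-enumerable M (a , b , c , gen) = enumeration , enumerates
    where
      enumeration : ℕ → Carrier M
      enumeration n = nth M a b c (rounds M a b c (proj₁ (diagonal n))) (proj₂ (diagonal n))

      enumerates : Enumerates enumeration
      enumerates x with generated-in-rounds M a b c (gen x)
      ... | m , x∈ with nth-∈ M a b c x∈
      ...   | j , eq with diagonal-enumerates (m , j)
      ...     | n , refl = n , eq

module Finiteness where

  open import Data.Nat using (zero; suc)
  import Data.Fin as Fin
  open import Data.Fin.Properties using (all?; ¬∀⟶∃¬; ¬Fin0)
  open import Data.List.Membership.Propositional using (_∈_)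
  open import Data.List using (allFin)
  import Data.List as List
  open import Data.List.Membership.Propositional.Properties using (∈-map⁺; ∈-allFin)
  open import Data.List.Extrema.Nat using (argmax; f[xs]≤f[argmax])
  import Data.List.Relation.Unary.All as All
  open import Data.Product using (_,_)
  open import Data.Sum using (_⊎_; inj₁; inj₂)
  open import Relation.Nullary using (¬_; Dec; yes; no)
  open import Relation.Binary.PropositionalEquality using (subst)
  open import Function.Bundles using (Inverse)

  decide-all : (B : SteinerQuasigroup) → Finite B → {P : Carrier B → Set}
    → (∀ y → Dec (P y)) → (∀ y → P y) ⊎ ∃ λ y → ¬ P y
  decide-all B (n , iso) {P} P? = decide (all? (λ k → P? (from k)))
    where
      open Inverse iso
      decide : Dec (∀ k → P (from k)) → (∀ y → P y) ⊎ ∃ λ y → ¬ P y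
      decide (yes all) = inj₁ (λ y → subst P (strictlyInverseʳ y) (all (to y)))
      decide (no ¬all) = let (k , ¬Pk) = ¬∀⟶∃¬ n _ (λ k → P? (from k)) ¬all in inj₂ (from k , ¬Pk)

  maximum : (B : SteinerQuasigroup) → Finite B → (f : Carrier B → ℕ)
    → ¬ Carrier B ⊎ ∃ λ y₀ → ∀ y → f y ≤ f y₀
  maximum B (zero , iso) f = inj₁ (λ y → ¬Fin0 (Inverse.to iso y))
  maximum B (suc m , iso) f = inj₂ (top , λ y → All.lookup (f[xs]≤f[argmax] {f = f} (from Fin.zero) elements) (listed y))
    where
      open Inverse iso
      elements = List.map from (allFin (suc m))
      top = argmax f (from Fin.zero) elements
      listed : ∀ y → y ∈ elements
      listed y = subst (_∈ elements) (strictlyInverseʳ y) (∈-map⁺ from (∈-allFin (to y)))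

module Embeddings where

  open import Data.Product using (_,_; proj₁; proj₂)
  open import Data.Empty using (⊥-elim)
  open import Relation.Binary.PropositionalEquality using (_≡_; _≢_; refl; sym; trans; cong; cong₂; module ≡-Reasoning)

  module Laws (S : SteinerQuasigroup) where
    private
      infixl 7 _∙_
      _∙_ = _·_ S

    -- multiplication by a is injective, being its own inverse
    cancelˡ : ∀ a {x y} → a ∙ x ≡ a ∙ y → x ≡ y
    cancelˡ a {x} {y} eq = trans (sym (absorb S a x)) (trans (cong (a ∙_) eq) (absorb S a y))

    absorb-middle : ∀ a b → b ∙ (a ∙ b) ≡ a
    absorb-middle a b = trans (cong (b ∙_) (comm S a b)) (absorb S b a)

    absorb-left : ∀ a b → (a ∙ b) ∙ a ≡ b
    absorb-left a b = trans (comm S (a ∙ b) a) (absorb S a b)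

    absorb-right : ∀ a b → (a ∙ b) ∙ b ≡ a
    absorb-right a b = trans (comm S (a ∙ b) b) (absorb-middle a b)

    product≢left : ∀ {a b} → a ≢ b → a ∙ b ≢ a
    product≢left {a} {b} a≢b ab≡a = a≢b (sym (cancelˡ a (trans ab≡a (sym (idem S a)))))

    product≢right : ∀ {a b} → a ≢ b → a ∙ b ≢ b
    product≢right {a} {b} a≢b ab≡b = product≢left (λ b≡a → a≢b (sym b≡a)) (trans (comm S b a) ab≡b)

  data Three : Set where
    c₀ c₁ c₂ : Three

  _⊛_ : Three → Three → Three
  c₀ ⊛ c₀ = c₀
  c₀ ⊛ c₁ = c₂
  c₀ ⊛ c₂ = c₁
  c₁ ⊛ c₀ = c₂
  c₁ ⊛ c₁ = c₁
  c₁ ⊛ c₂ = c₀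
  c₂ ⊛ c₀ = c₁
  c₂ ⊛ c₁ = c₀
  c₂ ⊛ c₂ = c₂

  module Triangle (S : SteinerQuasigroup) (a b : Carrier S) where
    private
      infixl 7 _∙_
      _∙_ = _·_ S
    open Laws S

    corner : Three → Carrier S
    corner c₀ = a
    corner c₁ = b
    corner c₂ = a ∙ b

    corner-hom : ∀ t u → corner (t ⊛ u) ≡ corner t ∙ corner u
    corner-hom c₀ c₀ = sym (idem S a)
    corner-hom c₀ c₁ = refl
    corner-hom c₀ c₂ = sym (absorb S a b)
    corner-hom c₁ c₀ = comm S a b
    corner-hom c₁ c₁ = sym (idem S b)
    corner-hom c₁ c₂ = sym (absorb-middle a b)
    corner-hom c₂ c₀ = sym (absorb-left a b)
    corner-hom c₂ c₁ = sym (absorb-right a b)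
    corner-hom c₂ c₂ = sym (idem S (a ∙ b))

    corner-injective : a ≢ b → ∀ t u → corner t ≡ corner u → t ≡ u
    corner-injective a≢b c₀ c₀ _ = refl
    corner-injective a≢b c₁ c₁ _ = refl
    corner-injective a≢b c₂ c₂ _ = refl
    corner-injective a≢b c₀ c₁ eq = ⊥-elim (a≢b eq)
    corner-injective a≢b c₁ c₀ eq = ⊥-elim (a≢b (sym eq))
    corner-injective a≢b c₀ c₂ eq = ⊥-elim (product≢left a≢b (sym eq))
    corner-injective a≢b c₂ c₀ eq = ⊥-elim (product≢left a≢b eq)
    corner-injective a≢b c₁ c₂ eq = ⊥-elim (product≢right a≢b (sym eq))
    corner-injective a≢b c₂ c₁ eq = ⊥-elim (product≢right a≢b eq)

  open Embedding

  triangle-embedding : ∀ {B C D} (e : Embedding B C) {u v : Carrier C} → u ≢ v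
    → (∀ y → ∃ λ t → map e y ≡ Triangle.corner C u v t)
    → {α β : Carrier D} → α ≢ β → Embedding B D
  triangle-embedding {B} {C} {D} e {u} {v} u≢v position {α} {β} α≢β = record
    { map = λ y → D.corner (tag y)
    ; injective = λ {x} {y} eq → injective e (begin
        map e x          ≡⟨ proj₂ (position x) ⟩
        C.corner (tag x) ≡⟨ cong C.corner (D.corner-injective α≢β (tag x) (tag y) eq) ⟩
        C.corner (tag y) ≡⟨ proj₂ (position y) ⟨
        map e y          ∎)
    ; hom = λ x y → trans (cong D.corner (tag-hom x y)) (D.corner-hom (tag x) (tag y))
    }
    where
      module C = Triangle C u v
      module D = Triangle D α β
      open ≡-Reasoning

      tag : Carrier B → Three
      tag y = proj₁ (position y)

      tag-hom : ∀ x y → tag (_·_ B x y) ≡ tag x ⊛ tag y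
      tag-hom x y = C.corner-injective u≢v _ _ (begin
        C.corner (tag (_·_ B x y))          ≡⟨ proj₂ (position (_·_ B x y)) ⟨
        map e (_·_ B x y)                   ≡⟨ hom e x y ⟩
        _·_ C (map e x) (map e y)           ≡⟨ cong₂ (_·_ C) (proj₂ (position x)) (proj₂ (position y)) ⟩
        _·_ C (C.corner (tag x)) (C.corner (tag y)) ≡⟨ C.corner-hom (tag x) (tag y) ⟨
        C.corner (tag x ⊛ tag y)            ∎)

  subsingleton-embedding : ∀ {B D} → (∀ (x y : Carrier B) → x ≡ y) → Carrier D → Embedding B D
  subsingleton-embedding {D = D} unique α = record
    { map = λ _ → α
    ; injective = λ {x} {y} _ → unique x y
    ; hom = λ _ _ → sym (idem D α)
    }

  factor-embedding : ∀ {A B M} (e : Embedding B M) (g : Embedding A M)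
    → (∀ y → ∃ λ a → map g a ≡ map e y) → Embedding B A
  factor-embedding {A} {B} {M} e g preimage = record
    { map = pre
    ; injective = λ {x} {y} eq → injective e (begin
        map e x       ≡⟨ proj₂ (preimage x) ⟨
        map g (pre x) ≡⟨ cong (map g) eq ⟩
        map g (pre y) ≡⟨ proj₂ (preimage y) ⟩
        map e y       ∎)
    ; hom = λ x y → injective g (begin
        map g (pre (_·_ B x y))            ≡⟨ proj₂ (preimage (_·_ B x y)) ⟩
        map e (_·_ B x y)                  ≡⟨ hom e x y ⟩
        _·_ M (map e x) (map e y)          ≡⟨ cong₂ (_·_ M) (proj₂ (preimage x)) (proj₂ (preimage y)) ⟨
        _·_ M (map g (pre x)) (map g (pre y)) ≡⟨ hom g (pre x) (pre y) ⟨
        map g (_·_ A (pre x) (pre y))      ∎)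
    }
    where
      open ≡-Reasoning
      pre : Carrier B → Carrier A
      pre y = proj₁ (preimage y)

-- The line through p and q, if any, is
-- recorded by its third point; an injective coding into lists of numbers supplies
-- decidable equality and a linear order.
record PartialTripleSystem : Set₁ where
  field
    Point          : Set
    code           : Point → List ℕ
    code-injective : ∀ {p q} → code p ≡ code q → p ≡ q
    third          : Point → Point → Maybe Point
    third-comm     : ∀ {p q r} → third p q ≡ just r → third q p ≡ just r
    third-exchange : ∀ {p q r} → third p q ≡ just r → third p r ≡ just q
    third-distinct : ∀ {p q r} → third p q ≡ just r → p ≢ q

  third-symmetric : ∀ p q → third p q ≡ third q p
  third-symmetric p q with third p q in pq | third q p in qp
  ... | just r  | just s  = trans (sym pq) (third-comm qp)
  ... | just r  | nothing = trans (sym (third-comm pq)) qp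
  ... | nothing | just s  = trans (sym pq) (third-comm qp)
  ... | nothing | nothing = refl

-- New points are formal products of their two components, stored in increasing order,
-- and an element is valid if every new point in it completes a pair that had no line.
module FreeCompletion (S : PartialTripleSystem) where

  open PartialTripleSystem S
  open import Data.Nat using (suc; _<_; _⊔_; s≤s)
  open import Data.Nat.Properties using (m≤m⊔n; m≤n⊔m; <-asym; <-irrefl; <⇒≱)
  import Data.Nat.Properties as ℕ
  open import Data.List using (_∷_; []; _++_; length)
  open import Data.List.Properties using (∷-injective; ++-assoc; ++-identityʳ; ≡-dec)
  open import Data.List.Relation.Binary.Pointwise using (Pointwise-≡⇒≡)
  import Data.List.Relation.Binary.Lex.Strict as Lex
  open import Data.Maybe using (_<∣>_; is-nothing)
  import Data.Maybe as Maybe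
  open import Data.Maybe.Properties using (<∣>-identityʳ)
  open import Data.Bool using (Bool; true; T; _∧_)
  open import Data.Bool.Properties using (T-∧; T-irrelevant)
  open import Data.Unit using (tt)
  open import Data.Product using (_,_; proj₁; proj₂)
  open import Data.Sum using (_⊎_; inj₁; inj₂)
  open import Data.Empty using (⊥-elim)
  open import Relation.Nullary using (¬_; Dec; yes; no)
  open import Relation.Nullary.Decidable using (map′; ⌊_⌋; toWitness; fromWitness)
  open import Relation.Binary using (DecidableEquality; StrictTotalOrder; tri<; tri≈; tri>)
  open import Relation.Binary.PropositionalEquality using (cong; subst; ≡-≟-identity; ≢-≟-identity; module ≡-Reasoning)
  open import Function.Bundles using (Equivalence)
  open import Function using (_$_)

  data Elem : Set where
    base : Point → Elem
    new  : Elem → Elem → Elem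

  -- A prefix-free coding of elements by lists of numbers (the code of a point is preceded
  -- by its length).
  encode : Elem → List ℕ
  encode (base p) = 0 ∷ length (code p) ∷ code p
  encode (new x y) = 1 ∷ encode x ++ encode y

  ++-cancel-length : ∀ (xs ys : List ℕ) {r s} → length xs ≡ length ys → xs ++ r ≡ ys ++ s → xs ≡ ys × r ≡ s
  ++-cancel-length [] [] _ eq = refl , eq
  ++-cancel-length (x ∷ xs) (y ∷ ys) len eq with ∷-injective eq
  ... | refl , eq′ with ++-cancel-length xs ys (ℕ.suc-injective len) eq′
  ...   | refl , r≡s = refl , r≡s

  encode-prefix : ∀ x y {r s} → encode x ++ r ≡ encode y ++ s → x ≡ y × r ≡ s
  encode-prefix (base p) (base q) eq with ∷-injective (proj₂ (∷-injective eq))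
  ... | len , eq′ with ++-cancel-length (code p) (code q) len eq′
  ...   | codes , r≡s = cong base (code-injective codes) , r≡s
  encode-prefix (new x y) (new x′ y′) {r} {s} eq
    with encode-prefix x x′ (trans (sym (++-assoc (encode x) (encode y) r))
                             (trans (proj₂ (∷-injective eq)) (++-assoc (encode x′) (encode y′) s)))
  ... | refl , rest with encode-prefix y y′ rest
  ...   | refl , r≡s = refl , r≡s

  encode-injective : ∀ {x y} → encode x ≡ encode y → x ≡ y
  encode-injective {x} {y} eq =
    proj₁ (encode-prefix x y (trans (++-identityʳ (encode x)) (trans eq (sym (++-identityʳ (encode y))))))

  _≟_ : DecidableEquality Elem
  x ≟ y = map′ encode-injective (cong encode) (≡-dec ℕ._≟_ (encode x) (encode y))

  private
    module Codes = StrictTotalOrder (Lex.<-strictTotalOrder ℕ.<-strictTotalOrder)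

  _≺_ : Elem → Elem → Set
  x ≺ y = Codes._<_ (encode x) (encode y)

  _≺?_ : ∀ x y → Dec (x ≺ y)
  x ≺? y = encode x Codes.<? encode y

  ≺-asym : ∀ {x y} → x ≺ y → ¬ y ≺ x
  ≺-asym = Codes.asym

  ≺-connex : ∀ {x y} → x ≢ y → x ≺ y ⊎ y ≺ x
  ≺-connex {x} {y} x≢y with Codes.compare (encode x) (encode y)
  ... | tri< x≺y _ _ = inj₁ x≺y
  ... | tri≈ _ codes _ = ⊥-elim (x≢y (encode-injective (Pointwise-≡⇒≡ codes)))
  ... | tri> _ _ y≺x = inj₂ y≺x

  rank : (Point → ℕ) → Elem → ℕ
  rank ρ (base p) = ρ p
  rank ρ (new x y) = suc (rank ρ x ⊔ rank ρ y)

  rank-left : ∀ ρ x y → rank ρ x < rank ρ (new x y)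
  rank-left ρ x y = s≤s (m≤m⊔n (rank ρ x) (rank ρ y))

  rank-right : ∀ ρ x y → rank ρ y < rank ρ (new x y)
  rank-right ρ x y = s≤s (m≤n⊔m (rank ρ x) (rank ρ y))

  data Parts : Elem → Elem → Elem → Set where
    left  : ∀ {u v} → Parts (new u v) u v
    right : ∀ {u v} → Parts (new u v) v u

  parts-swap : ∀ {c y z} → Parts c y z → Parts c z y
  parts-swap left = right
  parts-swap right = left

  parts-below : ∀ ρ {c y z} → Parts c y z → rank ρ y < rank ρ c
  parts-below ρ (left {u} {v}) = rank-left ρ u v
  parts-below ρ (right {u} {v}) = rank-right ρ u v

  -- A new point differs from its components; compare heights, the ranks with all points at 0.
  parts-≢ : ∀ {c y z} → Parts c y z → c ≢ y
  parts-≢ {c} c∋y refl = <-irrefl refl (parts-below (λ _ → 0) c∋y)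

  partner : Elem → Elem → Maybe Elem
  partner (base _) y = nothing
  partner (new u v) y with y ≟ u | y ≟ v
  ... | yes _ | _     = just v
  ... | no _  | yes _ = just u
  ... | no _  | no _  = nothing

  partner-parts : ∀ {c y z} → partner c y ≡ just z → Parts c y z
  partner-parts {new u v} {y} eq with y ≟ u | y ≟ v
  partner-parts refl | yes refl | _      = left
  partner-parts refl | no _     | yes refl = right

  join : Elem → Elem → Maybe Elem
  join (base p) (base q) = Maybe.map base (third p q)
  join x y = partner x y <∣> partner y x

  data Joined : Elem → Elem → Elem → Set where
    line : ∀ {p q r} → third p q ≡ just r → Joined (base p) (base q) (base r)
    down : ∀ {x y z} → Parts x y z → Joined x y z
    up   : ∀ {x y z} → Parts y x z → Joined x y z

  join-joined : ∀ x y {z} → join x y ≡ just z → Joined x y z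
  join-joined (base p) (base q) eq with third p q in pq
  join-joined (base p) (base q) refl | just r = line pq
  join-joined (base p) (new u v) eq = up (partner-parts eq)
  join-joined (new u v) y eq with partner (new u v) y in e
  join-joined (new u v) y refl | just z = down (partner-parts e)
  ... | nothing = up (partner-parts eq)

  -- join is symmetric, as no two elements are components of each other.
  join-comm : ∀ x y → join x y ≡ join y x
  join-comm (base p) (base q) = cong (Maybe.map base) (third-symmetric p q)
  join-comm (base p) (new u v) = sym (<∣>-identityʳ _)
  join-comm (new u v) (base p) = <∣>-identityʳ _
  join-comm (new u v) (new u′ v′)
    with partner (new u v) (new u′ v′) in e | partner (new u′ v′) (new u v) in e′
  ... | nothing | nothing = refl
  ... | nothing | just _  = refl
  ... | just _  | nothing = refl
  ... | just _  | just _  = ⊥-elim (<-asym (parts-below (λ _ → 0) (partner-parts e))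
                                           (parts-below (λ _ → 0) (partner-parts e′)))

  valid : Elem → Bool
  valid (base _) = true
  valid (new u v) = valid u ∧ (valid v ∧ (⌊ u ≺? v ⌋ ∧ is-nothing (join u v)))

  -- (a record, so that x can be inferred from a proof of validity)
  record Valid (x : Elem) : Set where
    constructor valid✓
    field is-valid : T (valid x)

  Valid-irrelevant : ∀ {x} (a b : Valid x) → a ≡ b
  Valid-irrelevant (valid✓ a) (valid✓ b) = cong valid✓ (T-irrelevant a b)

  record ValidNew (u v : Elem) : Set where
    field
      valid-left  : Valid u
      valid-right : Valid v
      increasing  : u ≺ v
      unjoined    : join u v ≡ nothing

  valid-new : ∀ {u v} → Valid (new u v) → ValidNew u v
  valid-new {u} {v} (valid✓ t) with Equivalence.to T-∧ t
  ... | vu , t′ with Equivalence.to T-∧ t′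
  ... | vv , t″ with Equivalence.to T-∧ t″
  ... | u≺v , unjoined = record
    { valid-left = valid✓ vu ; valid-right = valid✓ vv ; increasing = toWitness u≺v ; unjoined = nothing! unjoined }
    where
      nothing! : ∀ {m : Maybe Elem} → T (is-nothing m) → m ≡ nothing
      nothing! {nothing} _ = refl

  new-valid : ∀ {u v} → ValidNew u v → Valid (new u v)
  new-valid {u} {v} record { valid-left = valid✓ vu ; valid-right = valid✓ vv ; increasing = u≺v ; unjoined = unjoined } =
    valid✓ $ Equivalence.from T-∧ (vu , Equivalence.from T-∧ (vv , Equivalence.from T-∧ (fromWitness u≺v , T-nothing unjoined)))
    where
      T-nothing : ∀ {m : Maybe Elem} → m ≡ nothing → T (is-nothing m)
      T-nothing refl = tt

  components-≢ : ∀ {u v} → Valid (new u v) → u ≢ v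
  components-≢ t refl = ≺-asym u≺u u≺u
    where u≺u = ValidNew.increasing (valid-new t)

  ordered : Elem → Elem → Elem
  ordered x y with x ≺? y
  ... | yes _ = new x y
  ... | no _  = new y x

  ordered-cases : ∀ {x y} → x ≢ y → (ordered x y ≡ new x y × x ≺ y) ⊎ (ordered x y ≡ new y x × y ≺ x)
  ordered-cases {x} {y} x≢y with x ≺? y
  ... | yes x≺y = inj₁ (refl , x≺y)
  ... | no x⊀y with ≺-connex x≢y
  ...   | inj₁ x≺y = ⊥-elim (x⊀y x≺y)
  ...   | inj₂ y≺x = inj₂ (refl , y≺x)

  ordered-increasing : ∀ {x y} → x ≺ y → ordered x y ≡ new x y
  ordered-increasing {x} {y} x≺y with x ≺? y
  ... | yes _ = refl
  ... | no x⊀y = ⊥-elim (x⊀y x≺y)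

  ordered-comm : ∀ {x y} → x ≢ y → ordered x y ≡ ordered y x
  ordered-comm {x} {y} x≢y with ordered-cases x≢y | ordered-cases (λ y≡x → x≢y (sym y≡x))
  ... | inj₁ (xy , _)   | inj₂ (yx , _)   = trans xy (sym yx)
  ... | inj₂ (xy , _)   | inj₁ (yx , _)   = trans xy (sym yx)
  ... | inj₁ (_ , x≺y) | inj₁ (_ , y≺x) = ⊥-elim (≺-asym x≺y y≺x)
  ... | inj₂ (_ , y≺x) | inj₂ (_ , x≺y) = ⊥-elim (≺-asym x≺y y≺x)

  ordered-parts : ∀ {x y} → x ≢ y → Parts (ordered x y) x y
  ordered-parts x≢y with ordered-cases x≢y
  ... | inj₁ (eq , _) rewrite eq = left
  ... | inj₂ (eq , _) rewrite eq = right

  infixl 7 _∙_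
  _∙_ : Elem → Elem → Elem
  x ∙ y with x ≟ y
  ... | yes _ = x
  ... | no _ with join x y
  ...   | just z  = z
  ...   | nothing = ordered x y

  ∙-idem : ∀ x → x ∙ x ≡ x
  ∙-idem x rewrite ≡-≟-identity _≟_ {x} refl = refl

  ∙-joined : ∀ {x y z} → x ≢ y → join x y ≡ just z → x ∙ y ≡ z
  ∙-joined x≢y eq rewrite ≢-≟-identity _≟_ x≢y | eq = refl

  ∙-fresh : ∀ {x y} → x ≢ y → join x y ≡ nothing → x ∙ y ≡ ordered x y
  ∙-fresh x≢y eq rewrite ≢-≟-identity _≟_ x≢y | eq = refl

  ∙-comm : ∀ x y → x ∙ y ≡ y ∙ x
  ∙-comm x y with x ≟ y
  ... | yes refl = sym (∙-idem x)
  ... | no x≢y with join x y in xy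
  ...   | just z  = sym (∙-joined y≢x (trans (join-comm y x) xy))
    where y≢x = λ y≡x → x≢y (sym y≡x)
  ...   | nothing = trans (ordered-comm x≢y) (sym (∙-fresh y≢x (trans (join-comm y x) xy)))
    where y≢x = λ y≡x → x≢y (sym y≡x)

  parts-valid : ∀ {c y z} → Valid c → Parts c y z → Valid y × Valid z
  parts-valid vc left  = ValidNew.valid-left (valid-new vc) , ValidNew.valid-right (valid-new vc)
  parts-valid vc right = ValidNew.valid-right (valid-new vc) , ValidNew.valid-left (valid-new vc)

  parts-partner : ∀ {c y z} → Valid c → Parts c y z → partner c y ≡ just z
  parts-partner {new u v} {y} vc c∋y with y ≟ u | y ≟ v
  parts-partner vc left  | yes _    | _      = refl
  parts-partner vc left  | no u≢u   | _      = ⊥-elim (u≢u refl)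
  parts-partner vc right | yes refl | _      = ⊥-elim (components-≢ vc refl)
  parts-partner vc right | no _     | yes _  = refl
  parts-partner vc right | no _     | no v≢v = ⊥-elim (v≢v refl)

  joined-valid : ∀ {x y z} → Valid x → Valid y → Joined x y z → Valid z
  joined-valid vx vy (line _) = valid✓ tt
  joined-valid vx vy (down x∋y) = proj₂ (parts-valid vx x∋y)
  joined-valid vx vy (up y∋x) = proj₂ (parts-valid vy y∋x)

  ordered-valid : ∀ {x y} → Valid x → Valid y → x ≢ y → join x y ≡ nothing → Valid (ordered x y)
  ordered-valid {x} {y} vx vy x≢y unjoined with ordered-cases x≢y
  ... | inj₁ (eq , x≺y) = subst Valid (sym eq) (new-valid record
    { valid-left = vx ; valid-right = vy ; increasing = x≺y ; unjoined = unjoined })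
  ... | inj₂ (eq , y≺x) = subst Valid (sym eq) (new-valid record
    { valid-left = vy ; valid-right = vx ; increasing = y≺x ; unjoined = trans (join-comm y x) unjoined })

  ∙-valid : ∀ {x y} → Valid x → Valid y → Valid (x ∙ y)
  ∙-valid {x} {y} vx vy with x ≟ y
  ... | yes _ = vx
  ... | no x≢y with join x y in xy
  ...   | just z  = joined-valid vx vy (join-joined x y xy)
  ...   | nothing = ordered-valid vx vy x≢y xy

  components-product : ∀ {u v} → Valid (new u v) → u ∙ v ≡ new u v
  components-product t = trans (∙-fresh (components-≢ t) (ValidNew.unjoined (valid-new t)))
                                (ordered-increasing (ValidNew.increasing (valid-new t)))

  ∙-partner : ∀ {c y z} → Valid c → Parts c y z → c ∙ y ≡ z
  ∙-partner {new u v} {y} vc c∋y = ∙-joined (parts-≢ c∋y) (cong (_<∣> partner y (new u v)) (parts-partner vc c∋y))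

  joined-exchange : ∀ {x y z} → Valid x → Valid y → Joined x y z → x ∙ z ≡ y
  joined-exchange {base p} {_} {base r} vx vy (line pq) =
    ∙-joined {base p} {base r} (λ { refl → third-distinct pr refl }) (cong (Maybe.map base) pr)
    where pr = third-exchange pq
  joined-exchange vx vy (down x∋y) = ∙-partner vx (parts-swap x∋y)
  joined-exchange vx vy (up left) = components-product vy
  joined-exchange {x} {_} {z} vx vy (up right) = trans (∙-comm x z) (components-product vy)

  ∙-absorb : ∀ {x y} → Valid x → Valid y → x ∙ (x ∙ y) ≡ y
  ∙-absorb {x} {y} vx vy = by-cases (x ≟ y) (join x y) refl
    where
      open ≡-Reasoning
      by-cases : Dec (x ≡ y) → (m : Maybe Elem) → join x y ≡ m → x ∙ (x ∙ y) ≡ y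
      by-cases (yes refl) _ _ = trans (cong (x ∙_) (∙-idem x)) (∙-idem x)
      by-cases (no x≢y) (just z) xy =
        trans (cong (x ∙_) (∙-joined x≢y xy)) (joined-exchange vx vy (join-joined x y xy))
      by-cases (no x≢y) nothing xy = begin
        x ∙ (x ∙ y)          ≡⟨ cong (x ∙_) (∙-fresh x≢y xy) ⟩
        x ∙ ordered x y      ≡⟨ ∙-comm x (ordered x y) ⟩
        ordered x y ∙ x      ≡⟨ ∙-partner (ordered-valid vx vy x≢y xy) (ordered-parts x≢y) ⟩
        y                    ∎

  Valid-≡ : ∀ {x y} {vx : Valid x} {vy : Valid y} → x ≡ y → (x , vx) ≡ (y , vy)
  Valid-≡ {x} {vx = vx} {vy} refl = cong (x ,_) (Valid-irrelevant vx vy)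

  completion : SteinerQuasigroup
  completion = record
    { Carrier = Σ Elem Valid
    ; _·_     = λ (x , vx) (y , vy) → x ∙ y , ∙-valid vx vy
    ; comm    = λ (x , _) (y , _) → Valid-≡ (∙-comm x y)
    ; idem    = λ (x , _) → Valid-≡ (∙-idem x)
    ; absorb  = λ (x , vx) (y , vy) → Valid-≡ (∙-absorb vx vy)
    }

  _≟ᴹ_ : DecidableEquality (Carrier completion)
  (x , _) ≟ᴹ (y , _) = map′ Valid-≡ (cong proj₁) (x ≟ y)

  point : Point → Carrier completion
  point p = base p , valid✓ tt

  point-injective : ∀ {p q} → point p ≡ point q → p ≡ q
  point-injective refl = refl

  point-line : ∀ {p q r} → third p q ≡ just r → _·_ completion (point p) (point q) ≡ point r
  point-line {p} {q} pq = Valid-≡ (∙-joined {base p} {base q} (λ { refl → third-distinct pq refl })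
                                             (cong (Maybe.map base) pq))

  completion-induction : (G : Carrier completion → Set)
    → (∀ {x y} → G x → G y → G (_·_ completion x y)) → (∀ p → G (point p)) → ∀ x → G x
  completion-induction G closed at-points (x , vx) = induction x vx
    where
      induction : ∀ x (vx : Valid x) → G (x , vx)
      induction (base p) (valid✓ tt) = at-points p
      induction (new u v) vc = subst G (Valid-≡ (components-product vc))
        (closed (induction u (ValidNew.valid-left (valid-new vc))) (induction v (ValidNew.valid-right (valid-new vc))))

  data Below (ρ : Point → ℕ) : Elem → Elem → Set where
    on-line   : ∀ {p q r} → third p q ≡ just r → ρ q ≤ ρ p → ρ r ≤ ρ p → Below ρ (base p) (base q)
    component : ∀ {x y z} → Parts x y z → Below ρ x y

  -- If neither y nor x ∙ y ranks above x, then y lies below x: a product of elements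
  -- not yet on a line is a new point, which ranks above both factors.
  below-top : ∀ ρ {x y} → x ≢ y → rank ρ y ≤ rank ρ x → rank ρ (x ∙ y) ≤ rank ρ x → Below ρ x y
  below-top ρ {x} {y} x≢y y≤x xy≤x = by-cases (join x y) refl
    where
      by-cases : (m : Maybe Elem) → join x y ≡ m → Below ρ x y
      by-cases nothing xy = ⊥-elim (<⇒≱ (parts-below ρ (ordered-parts x≢y))
                                        (subst (λ w → rank ρ w ≤ rank ρ x) (∙-fresh x≢y xy) xy≤x))
      by-cases (just z) xy with join-joined x y xy
      ... | line pq = on-line pq y≤x (subst (λ w → rank ρ w ≤ rank ρ x) (∙-joined x≢y xy) xy≤x)
      ... | down x∋y = component x∋y
      ... | up y∋x = ⊥-elim (<⇒≱ (parts-below ρ y∋x) y≤x)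

module Construction (A : ℕ → SteinerQuasigroup) (fin : ∀ i → Finite (A i)) where

  open import Data.Nat using (zero; suc; _+_; _*_; _<_; _<?_; z≤n; s≤s)
  import Data.Nat.Properties as ℕ
  open import Data.Fin using (toℕ; fromℕ<)
  open import Data.Fin.Properties using (toℕ-injective; toℕ<n; toℕ-fromℕ<)
  open import Data.List using (_∷_; [])
  open import Data.List.Properties using (∷-injective)
  open import Data.Maybe using (_<∣>_)
  open import Data.Maybe.Properties using (just-injective)
  import Data.Maybe as Maybe
  open import Data.Product using (_,_; proj₁; proj₂)
  open import Data.Sum using (_⊎_; inj₁; inj₂; map₂)
  open import Data.Empty using (⊥-elim)
  open import Data.Unit using (tt)
  open import Relation.Nullary using (¬_; Dec; yes; no)
  open import Relation.Nullary.Decidable using (map′)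
  open import Relation.Binary using (DecidableEquality)
  open import Relation.Binary.PropositionalEquality using (cong; subst; ≡-≟-identity; ≢-≟-identity; module ≡-Reasoning)
  open import Function.Bundles using (Inverse)
  open Finiteness using (decide-all; maximum)

  size : ℕ → ℕ
  size i = card (A i) (fin i)

  index : ∀ {i} → Carrier (A i) → ℕ
  index {i} a = toℕ (Inverse.to (proj₂ (fin i)) a)

  index-injective : ∀ {i} {a b : Carrier (A i)} → index a ≡ index b → a ≡ b
  index-injective {i} {a} {b} eq = begin
    a                      ≡⟨ strictlyInverseʳ a ⟨
    from (to a)            ≡⟨ cong from (toℕ-injective eq) ⟩
    from (to b)            ≡⟨ strictlyInverseʳ b ⟩
    b                      ∎
    where
      open Inverse (proj₂ (fin i)) using (to; from; strictlyInverseʳ)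
      open ≡-Reasoning

  index-< : ∀ {i} (a : Carrier (A i)) → index a < size i
  index-< {i} a = toℕ<n (Inverse.to (proj₂ (fin i)) a)

  element : ∀ i k → k < size i → Carrier (A i)
  element i k k< = Inverse.from (proj₂ (fin i)) (fromℕ< k<)

  index-element : ∀ i k (k< : k < size i) → index (element i k k<) ≡ k
  index-element i k k< = trans (cong toℕ (Inverse.strictlyInverseˡ (proj₂ (fin i)) (fromℕ< k<))) (toℕ-fromℕ< k<)

  _≟ₐ_ : ∀ {i} → DecidableEquality (Carrier (A i))
  a ≟ₐ b = map′ index-injective (cong index) (index a ℕ.≟ index b)

  data Chain : Set where
    trunk  : Chain
    branch : ℕ → Chain

  data Slot : Set where
    s₀ s₁ s₂ s₃ : Slot

  data Point : Set where
    g₁ g₂ : Point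
    link  : Chain → ℕ → Slot → Point
    elem  : (i : ℕ) → Carrier (A i) → Point

  chain-code : Chain → ℕ
  chain-code trunk = 0
  chain-code (branch i) = suc i

  chain-decode : ℕ → Chain
  chain-decode zero = trunk
  chain-decode (suc i) = branch i

  chain-code-injective : ∀ {c c′} → chain-code c ≡ chain-code c′ → c ≡ c′
  chain-code-injective {c} {c′} eq = trans (decode c) (trans (cong chain-decode eq) (sym (decode c′)))
    where
      decode : ∀ c → c ≡ chain-decode (chain-code c)
      decode trunk = refl
      decode (branch i) = refl

  _≟ᶜ_ : DecidableEquality Chain
  c ≟ᶜ c′ = map′ chain-code-injective (cong chain-code) (chain-code c ℕ.≟ chain-code c′)

  slot-code : Slot → ℕ
  slot-code s₀ = 0
  slot-code s₁ = 1
  slot-code s₂ = 2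
  slot-code s₃ = 3

  slot-code-injective : ∀ {s s′} → slot-code s ≡ slot-code s′ → s ≡ s′
  slot-code-injective {s} {s′} eq = trans (decode s) (trans (cong slot-decode eq) (sym (decode s′)))
    where
      slot-decode : ℕ → Slot
      slot-decode 0 = s₀
      slot-decode 1 = s₁
      slot-decode 2 = s₂
      slot-decode _ = s₃
      decode : ∀ s → s ≡ slot-decode (slot-code s)
      decode s₀ = refl
      decode s₁ = refl
      decode s₂ = refl
      decode s₃ = refl

  code : Point → List ℕ
  code g₁ = 0 ∷ []
  code g₂ = 1 ∷ []
  code (link c k s) = 2 ∷ chain-code c ∷ k ∷ slot-code s ∷ []
  code (elem i a) = 3 ∷ i ∷ index a ∷ []

  code-injective : ∀ {p q} → code p ≡ code q → p ≡ q
  code-injective {g₁} {g₁} _ = refl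
  code-injective {g₂} {g₂} _ = refl
  code-injective {link c k s} {link c′ k′ s′} eq
    with ∷-injective (proj₂ (∷-injective eq))
  ... | cc , eq′ with ∷-injective eq′
  ... | refl , eq″ with chain-code-injective cc | slot-code-injective (proj₁ (∷-injective eq″))
  ... | refl | refl = refl
  code-injective {elem i a} {elem j b} eq with ∷-injective (proj₂ (∷-injective eq))
  ... | refl , eq′ = cong (elem i) (index-injective (proj₁ (∷-injective eq′)))
  code-injective {g₁} {g₂} ()
  code-injective {g₁} {link _ _ _} ()
  code-injective {g₁} {elem _ _} ()
  code-injective {g₂} {g₁} ()
  code-injective {g₂} {link _ _ _} ()
  code-injective {g₂} {elem _ _} ()
  code-injective {link _ _ _} {g₁} ()
  code-injective {link _ _ _} {g₂} ()
  code-injective {link _ _ _} {elem _ _} ()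
  code-injective {elem _ _} {g₁} ()
  code-injective {elem _ _} {g₂} ()
  code-injective {elem _ _} {link _ _ _} ()

  data Line : Point → Point → Point → Set where
    a-low  : ∀ c k → Line g₁ (link c k s₀) (link c k s₁)
    a-high : ∀ c k → Line g₁ (link c k s₂) (link c k s₃)
    b-mid  : ∀ c k → Line g₂ (link c k s₁) (link c k s₂)
    b-next : ∀ c k → Line g₂ (link c k s₃) (link c (suc k) s₀)
    sprout : ∀ i → Line (link trunk i s₀) (link trunk i s₂) (link (branch i) 0 s₀)
    attach : ∀ i a → Line (link (branch i) (index a) s₀) (link (branch i) (index a) s₂) (elem i a)
    block  : ∀ i {a b} → a ≢ b → Line (elem i a) (elem i b) (elem i (_·_ (A i) a b))

  data Collinear (p q r : Point) : Set where
    pqr : Line p q r → Collinear p q r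
    qpr : Line q p r → Collinear p q r
    prq : Line p r q → Collinear p q r
    rpq : Line r p q → Collinear p q r
    qrp : Line q r p → Collinear p q r
    rqp : Line r q p → Collinear p q r

  collinear-swap₁₂ : ∀ {p q r} → Collinear p q r → Collinear q p r
  collinear-swap₁₂ (pqr l) = qpr l
  collinear-swap₁₂ (qpr l) = pqr l
  collinear-swap₁₂ (prq l) = qrp l
  collinear-swap₁₂ (rpq l) = rqp l
  collinear-swap₁₂ (qrp l) = prq l
  collinear-swap₁₂ (rqp l) = rpq l

  collinear-swap₂₃ : ∀ {p q r} → Collinear p q r → Collinear p r q
  collinear-swap₂₃ (pqr l) = prq l
  collinear-swap₂₃ (qpr l) = rpq l
  collinear-swap₂₃ (prq l) = pqr l
  collinear-swap₂₃ (rpq l) = qpr l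
  collinear-swap₂₃ (qrp l) = rqp l
  collinear-swap₂₃ (rqp l) = qrp l

  g₁-partner : Slot → Slot
  g₁-partner s₀ = s₁
  g₁-partner s₁ = s₀
  g₁-partner s₂ = s₃
  g₁-partner s₃ = s₂

  g₂-partner : Chain → ℕ → Slot → Maybe Point
  g₂-partner c k       s₁ = just (link c k s₂)
  g₂-partner c k       s₂ = just (link c k s₁)
  g₂-partner c k       s₃ = just (link c (suc k) s₀)
  g₂-partner c zero    s₀ = nothing
  g₂-partner c (suc k) s₀ = just (link c k s₃)

  offspring : Chain → ℕ → Maybe Point
  offspring trunk i = just (link (branch i) 0 s₀)
  offspring (branch i) k with k <? size i
  ... | yes k< = just (elem i (element i k k<))
  ... | no _   = nothing

  level-third : Chain → ℕ → Slot → Slot → Maybe Point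
  level-third c k s₀ s₁ = just g₁
  level-third c k s₁ s₀ = just g₁
  level-third c k s₂ s₃ = just g₁
  level-third c k s₃ s₂ = just g₁
  level-third c k s₁ s₂ = just g₂
  level-third c k s₂ s₁ = just g₂
  level-third c k s₀ s₂ = offspring c k
  level-third c k s₂ s₀ = offspring c k
  level-third c k _  _  = nothing

  step-third : Slot → Slot → Maybe Point
  step-third s₃ s₀ = just g₂
  step-third _  _  = nothing

  chain-third : Chain → ℕ → Slot → ℕ → Slot → Maybe Point
  chain-third c k s k′ s′ with k ℕ.≟ k′
  ... | yes _ = level-third c k s s′
  ... | no _ with k′ ℕ.≟ suc k
  ...   | yes _ = step-third s s′
  ...   | no _ with k ℕ.≟ suc k′
  ...     | yes _ = step-third s′ s
  ...     | no _  = nothing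

  from-offspring : Chain → ℕ → Slot → Chain → ℕ → Maybe Point
  from-offspring c k s c′ k′ with c ≟ᶜ c′ | k ℕ.≟ k′
  ... | yes _ | yes _ = opposite s
    where
      opposite : Slot → Maybe Point
      opposite s₀ = just (link c k s₂)
      opposite s₂ = just (link c k s₀)
      opposite _  = nothing
  ... | _ | _ = nothing

  sprout-third : Chain → ℕ → Slot → Chain → ℕ → Slot → Maybe Point
  sprout-third c k s (branch i) zero s₀ = from-offspring c k s trunk i
  sprout-third c k s _ _ _ = nothing

  block-third : ∀ i → Carrier (A i) → ∀ j → Carrier (A j) → Maybe Point
  block-third i a j b with i ℕ.≟ j
  ... | no _ = nothing
  ... | yes refl with a ≟ₐ b
  ...   | yes _ = nothing
  ...   | no _  = just (elem i (_·_ (A i) a b))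

  third : Point → Point → Maybe Point
  third g₁ (link c k s) = just (link c k (g₁-partner s))
  third g₂ (link c k s) = g₂-partner c k s
  third (link c k s) g₁ = just (link c k (g₁-partner s))
  third (link c k s) g₂ = g₂-partner c k s
  third (link c k s) (link c′ k′ s′) with c ≟ᶜ c′
  ... | yes _ = chain-third c k s k′ s′
  ... | no _  = sprout-third c k s c′ k′ s′ <∣> sprout-third c′ k′ s′ c k s
  third (link c k s) (elem i a) = from-offspring c k s (branch i) (index a)
  third (elem i a) (link c k s) = from-offspring c k s (branch i) (index a)
  third (elem i a) (elem j b) = block-third i a j b
  third _ _ = nothing

  data Opposite (c : Chain) (k : ℕ) : Slot → Point → Set where
    low  : Opposite c k s₀ (link c k s₂)
    high : Opposite c k s₂ (link c k s₀)

  from-offspring-sound : ∀ {c k s c′ k′ r} → from-offspring c k s c′ k′ ≡ just r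
    → c ≡ c′ × k ≡ k′ × Opposite c k s r
  from-offspring-sound {c} {k} {s} {c′} {k′} eq with c ≟ᶜ c′ | k ℕ.≟ k′
  from-offspring-sound {s = s₀} refl | yes c≡c′ | yes k≡k′ = c≡c′ , k≡k′ , low
  from-offspring-sound {s = s₂} refl | yes c≡c′ | yes k≡k′ = c≡c′ , k≡k′ , high
  from-offspring-sound {s = s₁} ()   | yes _ | yes _
  from-offspring-sound {s = s₃} ()   | yes _ | yes _
  from-offspring-sound ()            | yes _ | no _
  from-offspring-sound ()            | no _  | _

  sprout-sound : ∀ {c k s c′ k′ s′ r} → sprout-third c k s c′ k′ s′ ≡ just r
    → Collinear (link c k s) (link c′ k′ s′) r
  sprout-sound {c} {k} {s} {branch i} {zero} {s₀} eq with from-offspring-sound {c} {k} {s} eq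
  ... | refl , refl , low  = prq (sprout i)
  ... | refl , refl , high = rpq (sprout i)

  attach-sound : ∀ {c k s i a r} → from-offspring c k s (branch i) (index a) ≡ just r
    → Collinear (link c k s) (elem i a) r
  attach-sound {c} {k} {s} {i} {a} eq with from-offspring-sound {c} {k} {s} eq
  ... | refl , refl , low  = prq (attach i a)
  ... | refl , refl , high = rpq (attach i a)

  offspring-sound : ∀ {c k r} → offspring c k ≡ just r → Line (link c k s₀) (link c k s₂) r
  offspring-sound {trunk} {k} refl = sprout k
  offspring-sound {branch i} {k} eq with k <? size i
  offspring-sound {branch i} {k} refl | yes k< =
    subst (λ n → Line (link (branch i) n s₀) (link (branch i) n s₂) (elem i (element i k k<))) (index-element i k k<) (attach i _)

  level-sound : ∀ {c k s s′ r} → level-third c k s s′ ≡ just r → Collinear (link c k s) (link c k s′) r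
  level-sound {s = s₀} {s₁} refl = rpq (a-low _ _)
  level-sound {s = s₁} {s₀} refl = rqp (a-low _ _)
  level-sound {s = s₂} {s₃} refl = rpq (a-high _ _)
  level-sound {s = s₃} {s₂} refl = rqp (a-high _ _)
  level-sound {s = s₁} {s₂} refl = rpq (b-mid _ _)
  level-sound {s = s₂} {s₁} refl = rqp (b-mid _ _)
  level-sound {s = s₀} {s₂} eq = pqr (offspring-sound eq)
  level-sound {s = s₂} {s₀} eq = qpr (offspring-sound eq)

  step-sound : ∀ {s s′ r} → step-third s s′ ≡ just r → s ≡ s₃ × s′ ≡ s₀ × r ≡ g₂
  step-sound {s₃} {s₀} refl = refl , refl , refl

  chain-sound : ∀ {c k s k′ s′ r} → chain-third c k s k′ s′ ≡ just r → Collinear (link c k s) (link c k′ s′) r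
  chain-sound {c} {k} {s} {k′} {s′} eq with k ℕ.≟ k′
  ... | yes refl = level-sound eq
  ... | no _ with k′ ℕ.≟ suc k
  ...   | yes refl with step-sound {s} {s′} eq
  ...     | refl , refl , refl = rpq (b-next c k)
  chain-sound {c} {k} {s} {k′} {s′} eq | no _ | no _ with k ℕ.≟ suc k′
  ...   | yes refl with step-sound {s′} {s} eq
  ...     | refl , refl , refl = rqp (b-next c k′)

  block-sound : ∀ {i a j b r} → block-third i a j b ≡ just r → Collinear (elem i a) (elem j b) r
  block-sound {i} {a} {j} {b} eq with i ℕ.≟ j
  ... | yes refl with a ≟ₐ b
  block-sound {i} refl | yes refl | no a≢b = pqr (block i a≢b)

  g₁-sound : ∀ c k s → Collinear g₁ (link c k s) (link c k (g₁-partner s))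
  g₁-sound c k s₀ = pqr (a-low c k)
  g₁-sound c k s₁ = prq (a-low c k)
  g₁-sound c k s₂ = pqr (a-high c k)
  g₁-sound c k s₃ = prq (a-high c k)

  g₂-sound : ∀ {c k s r} → g₂-partner c k s ≡ just r → Collinear g₂ (link c k s) r
  g₂-sound {c} {suc k} {s₀} refl = prq (b-next c k)
  g₂-sound {c} {k} {s₁} refl = pqr (b-mid c k)
  g₂-sound {c} {k} {s₂} refl = prq (b-mid c k)
  g₂-sound {c} {k} {s₃} refl = pqr (b-next c k)

  third-sound : ∀ p q {r} → third p q ≡ just r → Collinear p q r
  third-sound g₁ (link c k s) refl = g₁-sound c k s
  third-sound g₂ (link c k s) eq = g₂-sound eq
  third-sound (link c k s) g₁ refl = collinear-swap₁₂ (g₁-sound c k s)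
  third-sound (link c k s) g₂ eq = collinear-swap₁₂ (g₂-sound eq)
  third-sound (link c k s) (link c′ k′ s′) eq with c ≟ᶜ c′
  ... | yes refl = chain-sound eq
  ... | no _ with sprout-third c k s c′ k′ s′ in e
  ...   | just _  = subst (Collinear _ _) (just-injective eq) (sprout-sound e)
  ...   | nothing = collinear-swap₁₂ (sprout-sound eq)
  third-sound (link c k s) (elem i a) eq = attach-sound eq
  third-sound (elem i a) (link c k s) eq = collinear-swap₁₂ (attach-sound eq)
  third-sound (elem i a) (elem j b) eq = block-sound eq

  private
    ℕ-refl : ∀ k → (k ℕ.≟ k) ≡ yes refl
    ℕ-refl k = ≡-≟-identity ℕ._≟_ refl

    chain-refl : ∀ c → (c ≟ᶜ c) ≡ yes refl
    chain-refl c = ≡-≟-identity _≟ᶜ_ refl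

    n≢1+n : ∀ n → n ≢ suc n
    n≢1+n n ()

    1+n≢n : ∀ n → suc n ≢ n
    1+n≢n n ()

    n≢2+n : ∀ n → n ≢ suc (suc n)
    n≢2+n n ()

  offspring-attach : ∀ i a → offspring (branch i) (index a) ≡ just (elem i a)
  offspring-attach i a with index a <? size i
  ... | yes a< = cong (λ b → just (elem i b)) (index-injective (index-element i (index a) a<))
  ... | no a≮ = ⊥-elim (a≮ (index-< a))

  block-third-line : ∀ i {a b c} → a ≢ b → _·_ (A i) a b ≡ c → block-third i a i b ≡ just (elem i c)
  block-third-line i a≢b refl rewrite ℕ-refl i | ≢-≟-identity _≟ₐ_ a≢b = refl

  module _ (i : ℕ) {a b : Carrier (A i)} (a≢b : a ≢ b) where
    open Embeddings.Laws (A i)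
    private
      b≢a : b ≢ a
      b≢a b≡a = a≢b (sym b≡a)

    block₂₁ : block-third i b i a ≡ just (elem i (_·_ (A i) a b))
    block₂₁ = block-third-line i b≢a (comm (A i) b a)
    block₁₃ : block-third i a i (_·_ (A i) a b) ≡ just (elem i b)
    block₁₃ = block-third-line i (λ eq → product≢left a≢b (sym eq)) (absorb (A i) a b)
    block₂₃ : block-third i b i (_·_ (A i) a b) ≡ just (elem i a)
    block₂₃ = block-third-line i (λ eq → product≢right a≢b (sym eq)) (absorb-middle a b)
    block₃₁ : block-third i (_·_ (A i) a b) i a ≡ just (elem i b)
    block₃₁ = block-third-line i (product≢left a≢b) (absorb-left a b)
    block₃₂ : block-third i (_·_ (A i) a b) i b ≡ just (elem i a)
    block₃₂ = block-third-line i (product≢right a≢b) (absorb-right a b)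

  third₁₂ : ∀ {x y z} → Line x y z → third x y ≡ just z
  third₁₂ (a-low c k) = refl
  third₁₂ (a-high c k) = refl
  third₁₂ (b-mid c k) = refl
  third₁₂ (b-next c k) = refl
  third₁₂ (sprout i) rewrite ℕ-refl i = refl
  third₁₂ (attach i a) rewrite chain-refl (branch i) | ℕ-refl (index a) = offspring-attach i a
  third₁₂ (block i a≢b) = block-third-line i a≢b refl

  third₂₁ : ∀ {x y z} → Line x y z → third y x ≡ just z
  third₂₁ (a-low c k) = refl
  third₂₁ (a-high c k) = refl
  third₂₁ (b-mid c k) = refl
  third₂₁ (b-next c k) = refl
  third₂₁ (sprout i) rewrite ℕ-refl i = refl
  third₂₁ (attach i a) rewrite chain-refl (branch i) | ℕ-refl (index a) = offspring-attach i a
  third₂₁ (block i a≢b) = block₂₁ i a≢b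

  third₁₃ : ∀ {x y z} → Line x y z → third x z ≡ just y
  third₁₃ (a-low c k) = refl
  third₁₃ (a-high c k) = refl
  third₁₃ (b-mid c k) = refl
  third₁₃ (b-next c k) = refl
  third₁₃ (sprout i) rewrite ℕ-refl i = refl
  third₁₃ (attach i a) rewrite chain-refl (branch i) | ℕ-refl (index a) = refl
  third₁₃ (block i a≢b) = block₁₃ i a≢b

  third₂₃ : ∀ {x y z} → Line x y z → third y z ≡ just x
  third₂₃ (a-low c k) rewrite chain-refl c | ℕ-refl k = refl
  third₂₃ (a-high c k) rewrite chain-refl c | ℕ-refl k = refl
  third₂₃ (b-mid c k) rewrite chain-refl c | ℕ-refl k = refl
  third₂₃ (b-next c k) rewrite chain-refl c | ≢-≟-identity ℕ._≟_ (n≢1+n k) | ℕ-refl (suc k) = refl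
  third₂₃ (sprout i) rewrite ℕ-refl i = refl
  third₂₃ (attach i a) rewrite chain-refl (branch i) | ℕ-refl (index a) = refl
  third₂₃ (block i a≢b) = block₂₃ i a≢b

  third₃₁ : ∀ {x y z} → Line x y z → third z x ≡ just y
  third₃₁ (a-low c k) = refl
  third₃₁ (a-high c k) = refl
  third₃₁ (b-mid c k) = refl
  third₃₁ (b-next c k) = refl
  third₃₁ (sprout i) rewrite ℕ-refl i = refl
  third₃₁ (attach i a) rewrite chain-refl (branch i) | ℕ-refl (index a) = refl
  third₃₁ (block i a≢b) = block₃₁ i a≢b

  third₃₂ : ∀ {x y z} → Line x y z → third z y ≡ just x
  third₃₂ (a-low c k) rewrite chain-refl c | ℕ-refl k = refl
  third₃₂ (a-high c k) rewrite chain-refl c | ℕ-refl k = refl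
  third₃₂ (b-mid c k) rewrite chain-refl c | ℕ-refl k = refl
  third₃₂ (b-next c k)
    rewrite chain-refl c | ≢-≟-identity ℕ._≟_ (1+n≢n k) | ≢-≟-identity ℕ._≟_ (n≢2+n k) | ℕ-refl (suc k) = refl
  third₃₂ (sprout i) rewrite ℕ-refl i = refl
  third₃₂ (attach i a) rewrite chain-refl (branch i) | ℕ-refl (index a) = refl
  third₃₂ (block i a≢b) = block₃₂ i a≢b

  third-complete : ∀ {p q r} → Collinear p q r → third p q ≡ just r
  third-complete (pqr l) = third₁₂ l
  third-complete (qpr l) = third₂₁ l
  third-complete (prq l) = third₁₃ l
  third-complete (rpq l) = third₂₃ l
  third-complete (qrp l) = third₃₁ l
  third-complete (rqp l) = third₃₂ l

  line-distinct : ∀ {x y z} → Line x y z → x ≢ y × x ≢ z × y ≢ z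
  line-distinct (a-low c k) = (λ ()) , (λ ()) , (λ ())
  line-distinct (a-high c k) = (λ ()) , (λ ()) , (λ ())
  line-distinct (b-mid c k) = (λ ()) , (λ ()) , (λ ())
  line-distinct (b-next c k) = (λ ()) , (λ ()) , (λ ())
  line-distinct (sprout i) = (λ ()) , (λ ()) , (λ ())
  line-distinct (attach i a) = (λ ()) , (λ ()) , (λ ())
  line-distinct (block i {a} {b} a≢b) =
    (λ { refl → a≢b refl }) , (λ { eq → product≢left a≢b (sym (elem-injective eq)) })
                            , (λ { eq → product≢right a≢b (sym (elem-injective eq)) })
    where
      open Embeddings.Laws (A i)
      elem-injective : ∀ {a b} → elem i a ≡ elem i b → a ≡ b
      elem-injective refl = refl

  collinear-distinct : ∀ {p q r} → Collinear p q r → p ≢ q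
  collinear-distinct (pqr l) = proj₁ (line-distinct l)
  collinear-distinct (qpr l) q≡p = proj₁ (line-distinct l) (sym q≡p)
  collinear-distinct (prq l) = proj₁ (proj₂ (line-distinct l))
  collinear-distinct (rpq l) = proj₂ (proj₂ (line-distinct l))
  collinear-distinct (qrp l) q≡p = proj₁ (proj₂ (line-distinct l)) (sym q≡p)
  collinear-distinct (rqp l) q≡p = proj₂ (proj₂ (line-distinct l)) (sym q≡p)

  system : PartialTripleSystem
  system = record
    { Point          = Point
    ; code           = code
    ; code-injective = code-injective
    ; third          = third
    ; third-comm     = λ {p} {q} pq → third-complete (collinear-swap₁₂ (third-sound p q pq))
    ; third-exchange = λ {p} {q} pq → third-complete (collinear-swap₂₃ (third-sound p q pq))
    ; third-distinct = λ {p} {q} pq → collinear-distinct (third-sound p q pq)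
    }

  open FreeCompletion system

  M : SteinerQuasigroup
  M = completion

  Gen : Carrier M → Set
  Gen = Generated M (point g₁) (point g₂) (point (link trunk 0 s₀))

  generate-line : ∀ {p q r} → Line p q r → Gen (point p) → Gen (point q) → Gen (point r)
  generate-line {p} {q} {r} l gp gq = subst Gen (point-line {p} {q} {r} (third₁₂ l)) (gen-· gp gq)

  generate-level : ∀ {c k} → Gen (point (link c k s₀)) → ∀ s → Gen (point (link c k s))
  generate-level {c} {k} g₀ = λ { s₀ → g₀ ; s₁ → g₁′ ; s₂ → g₂′ ; s₃ → g₃′ }
    where
      g₁′ = generate-line (a-low c k) gen-a g₀
      g₂′ = generate-line (b-mid c k) gen-b g₁′
      g₃′ = generate-line (a-high c k) gen-a g₂′

  generate-chain : ∀ {c} → Gen (point (link c 0 s₀)) → ∀ k s → Gen (point (link c k s))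
  generate-chain g zero = generate-level g
  generate-chain {c} g (suc k) =
    generate-level (generate-line (b-next c k) gen-b (generate-chain g k s₃))

  generate-trunk : ∀ k s → Gen (point (link trunk k s))
  generate-trunk = generate-chain gen-c

  generate-branch : ∀ i k s → Gen (point (link (branch i) k s))
  generate-branch i = generate-chain (generate-line (sprout i) (generate-trunk i s₀) (generate-trunk i s₂))

  generate-point : ∀ p → Gen (point p)
  generate-point g₁ = gen-a
  generate-point g₂ = gen-b
  generate-point (link trunk k s) = generate-trunk k s
  generate-point (link (branch i) k s) = generate-branch i k s
  generate-point (elem i a) =
    generate-line (attach i a) (generate-branch i (index a) s₀) (generate-branch i (index a) s₂)

  three-generated : ThreeGenerated M
  three-generated = point g₁ , point g₂ , point (link trunk 0 s₀) , completion-induction Gen gen-· generate-point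

  -- M is enumerated along its generation, and the links of the trunk are infinitely many.
  countably-infinite : CountablyInfinite M
  countably-infinite = Enumeration.countable _≟ᴹ_ (proj₂ (Enumeration.three-generated-enumerable M three-generated))
    {f = λ k → point (link trunk k s₀)} (λ eq → trunk-level (point-injective eq))
    where
      trunk-level : ∀ {k k′} → link trunk k s₀ ≡ link trunk k′ s₀ → k ≡ k′
      trunk-level refl = refl

  elem-embedding : ∀ i → Embedding (A i) M
  elem-embedding i = record
    { map = λ a → point (elem i a)
    ; injective = λ eq → elem-injective (point-injective eq)
    ; hom = hom
    }
    where
      elem-injective : ∀ {a b} → elem i a ≡ elem i b → a ≡ b
      elem-injective refl = refl
      hom : ∀ a b → point (elem i (_·_ (A i) a b)) ≡ _·_ M (point (elem i a)) (point (elem i b))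
      hom a b with a ≟ₐ b
      ... | yes refl = trans (cong (λ c → point (elem i c)) (idem (A i) a)) (sym (idem M (point (elem i a))))
      ... | no a≢b = sym (point-line {elem i a} {elem i b} (third₁₂ (block i a≢b)))

  -- Ranks: g₁ and g₂ at the bottom, then the links level by level (branch i starting
  -- above level i of the trunk), and the elements of A i above all links of branch i.
  origin : Chain → ℕ
  origin trunk = 0
  origin (branch i) = suc i * 4

  ρ : Point → ℕ
  ρ g₁ = 0
  ρ g₂ = 0
  ρ (link c k s) = suc (slot-code s + (k * 4 + origin c))
  ρ (elem i a) = suc (size i * 4 + origin (branch i))

  below-later-level : ∀ s {k n} o → k < n → slot-code s + (k * 4 + o) < n * 4 + o
  below-later-level s {k} {n} o k<n = ℕ.<-≤-trans (ℕ.+-monoˡ-< (k * 4 + o) (slot<4 s))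
                                                (ℕ.+-monoˡ-≤ o (ℕ.*-monoˡ-≤ 4 k<n))
    where
      slot<4 : ∀ s → slot-code s < 4
      slot<4 s₀ = s≤s z≤n
      slot<4 s₁ = s≤s (s≤s z≤n)
      slot<4 s₂ = s≤s (s≤s (s≤s z≤n))
      slot<4 s₃ = s≤s (s≤s (s≤s (s≤s z≤n)))

  sprout-rank : ∀ i s → ρ (link trunk i s) < ρ (link (branch i) 0 s₀)
  sprout-rank i s = s≤s (subst (slot-code s + (i * 4 + 0) <_) (ℕ.+-identityʳ (suc i * 4))
                               (below-later-level s 0 (ℕ.n<1+n i)))

  attach-rank : ∀ i a s → ρ (link (branch i) (index a) s) < ρ (elem i a)
  attach-rank i a s = s≤s (below-later-level s (suc i * 4) (index-< a))

  parents : Point → Maybe (Point × Point)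
  parents (link c k s₁) = just (g₁ , link c k s₀)
  parents (link c k s₂) = just (g₂ , link c k s₁)
  parents (link c k s₃) = just (g₁ , link c k s₂)
  parents (link c (suc k) s₀) = just (g₂ , link c k s₃)
  parents (link trunk zero s₀) = nothing
  parents (link (branch i) zero s₀) = just (link trunk i s₀ , link trunk i s₂)
  parents (elem i a) = just (link (branch i) (index a) s₀ , link (branch i) (index a) s₂)
  parents g₁ = nothing
  parents g₂ = nothing

  parents-line : ∀ {p u v} → parents p ≡ just (u , v) → Line u v p
  parents-line {link c k s₁} refl = a-low c k
  parents-line {link c k s₂} refl = b-mid c k
  parents-line {link c k s₃} refl = a-high c k
  parents-line {link c (suc k) s₀} refl = b-next c k
  parents-line {link (branch i) zero s₀} refl = sprout i
  parents-line {elem i a} refl = attach i a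

  data Apex : Point → Point → Point → Set where
    apex     : ∀ {x y z} → parents z ≡ just (x , y) → ρ x < ρ z → ρ y < ρ z → Apex x y z
    in-block : ∀ i {a b c} → Apex (elem i a) (elem i b) (elem i c)

  line-apex : ∀ {x y z} → Line x y z → Apex x y z
  line-apex (a-low c k) = apex refl (s≤s z≤n) ℕ.≤-refl
  line-apex (a-high c k) = apex refl (s≤s z≤n) ℕ.≤-refl
  line-apex (b-mid c k) = apex refl (s≤s z≤n) ℕ.≤-refl
  line-apex (b-next c k) = apex refl (s≤s z≤n) ℕ.≤-refl
  line-apex (sprout i) = apex refl (sprout-rank i s₀) (sprout-rank i s₂)
  line-apex (attach i a) = apex refl (attach-rank i a s₀) (attach-rank i a s₂)
  line-apex (block i _) = in-block i

  data Beneath : Point → Point → Set where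
    same-block : ∀ i {a b} → Beneath (elem i a) (elem i b)
    parent     : ∀ {p q u v} → parents p ≡ just (u , v) → q ≡ u ⊎ q ≡ v → Beneath p q

  line-beneath : ∀ {p q r} → third p q ≡ just r → ρ q ≤ ρ p → ρ r ≤ ρ p → Beneath p q
  line-beneath {p} {q} pq q≤p r≤p with third-sound p q pq
  ... | pqr l with line-apex l
  ...   | apex _ p<r _ = ⊥-elim (ℕ.<⇒≱ p<r r≤p)
  ...   | in-block i   = same-block i
  line-beneath pq q≤p r≤p | qpr l with line-apex l
  ...   | apex _ _ p<r = ⊥-elim (ℕ.<⇒≱ p<r r≤p)
  ...   | in-block i   = same-block i
  line-beneath pq q≤p r≤p | prq l with line-apex l
  ...   | apex _ p<q _ = ⊥-elim (ℕ.<⇒≱ p<q q≤p)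
  ...   | in-block i   = same-block i
  line-beneath pq q≤p r≤p | rpq l with line-apex l
  ...   | apex _ _ p<q = ⊥-elim (ℕ.<⇒≱ p<q q≤p)
  ...   | in-block i   = same-block i
  line-beneath pq q≤p r≤p | qrp l with line-apex l
  ...   | apex par _ _ = parent par (inj₁ refl)
  ...   | in-block i   = same-block i
  line-beneath pq q≤p r≤p | rqp l with line-apex l
  ...   | apex par _ _ = parent par (inj₂ refl)
  ...   | in-block i   = same-block i

  parentsᴱ : Elem → Maybe (Elem × Elem)
  parentsᴱ (base p) = Maybe.map (λ (u , v) → base u , base v) (parents p)
  parentsᴱ (new u v) = just (u , v)

  data Under : Elem → Elem → Set where
    same-block : ∀ i {a b} → Under (base (elem i a)) (base (elem i b))
    parent     : ∀ {x y u v} → parentsᴱ x ≡ just (u , v) → y ≡ u ⊎ y ≡ v → Under x y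

  below-under : ∀ {x y} → Below ρ x y → Under x y
  below-under (on-line pq q≤p r≤p) with line-beneath pq q≤p r≤p
  ... | same-block i = same-block i
  ... | parent par (inj₁ refl) = parent (cong (Maybe.map _) par) (inj₁ refl)
  ... | parent par (inj₂ refl) = parent (cong (Maybe.map _) par) (inj₂ refl)
  below-under (component left) = parent refl (inj₁ refl)
  below-under (component right) = parent refl (inj₂ refl)

  parents-product : ∀ {x u v} (vx : Valid x) → parentsᴱ x ≡ just (u , v)
    → Σ (Valid u) λ vu → Σ (Valid v) λ vv → u ≢ v × _·_ M (u , vu) (v , vv) ≡ (x , vx)
  parents-product {base p} vx par with parents p in par′
  parents-product {base p} vx refl | just (u , v) =
    valid✓ tt , valid✓ tt , (λ { refl → proj₁ (line-distinct (parents-line par′)) refl })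
    , Valid-≡ (cong proj₁ (point-line {u} {v} {p} (third₁₂ (parents-line par′))))
  parents-product {new u v} vx refl =
    ValidNew.valid-left (valid-new vx) , ValidNew.valid-right (valid-new vx) , components-≢ vx
    , Valid-≡ (components-product vx)

  InBlock : ℕ → Elem → Set
  InBlock i x = ∃ λ b → x ≡ base (elem i b)

  in-block? : ∀ i x → Dec (InBlock i x)
  in-block? i (base (elem j b)) with j ℕ.≟ i
  ... | yes refl = yes (b , refl)
  ... | no j≢i   = no λ { (_ , refl) → j≢i refl }
  in-block? i (base g₁) = no λ { (_ , ()) }
  in-block? i (base g₂) = no λ { (_ , ()) }
  in-block? i (base (link _ _ _)) = no λ { (_ , ()) }
  in-block? i (new _ _) = no λ { (_ , ()) }

  in-some-block? : ∀ x → (∃ λ i → InBlock i x) ⊎ (∀ i → ¬ InBlock i x)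
  in-some-block? (base (elem i b)) = inj₁ (i , b , refl)
  in-some-block? (base g₁) = inj₂ λ { _ (_ , ()) }
  in-some-block? (base g₂) = inj₂ λ { _ (_ , ()) }
  in-some-block? (base (link _ _ _)) = inj₂ λ { _ (_ , ()) }
  in-some-block? (new _ _) = inj₂ λ { _ (_ , ()) }

  under-outside : ∀ {x w} → (∀ i → ¬ InBlock i x) → Under x w
    → ∃ λ ((u , v) : Elem × Elem) → parentsᴱ x ≡ just (u , v) × (w ≡ u ⊎ w ≡ v)
  under-outside outside (same-block i {a}) = ⊥-elim (outside i (a , refl))
  under-outside outside (parent par w∈) = _ , par , w∈

  Attached : ∀ {i} → Carrier (A i) → Elem → Set
  Attached {i} a w = ∃ λ s → w ≡ base (link (branch i) (index a) s)

  under-block : ∀ {i a w} → Under (base (elem i a)) w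
    → InBlock i w ⊎ (w ≡ base (link (branch i) (index a) s₀) ⊎ w ≡ base (link (branch i) (index a) s₂))
  under-block (same-block i {b = b}) = inj₁ (b , refl)
  under-block (parent refl w∈) = inj₂ w∈

  attached : ∀ {i a w} → w ≡ base (link (branch i) (index a) s₀) ⊎ w ≡ base (link (branch i) (index a) s₂)
    → Attached a w
  attached (inj₁ eq) = s₀ , eq
  attached (inj₂ eq) = s₂ , eq

  attached-unique : ∀ {i} {a b : Carrier (A i)} {w} → Attached a w → Attached b w → a ≡ b
  attached-unique (s , refl) (s′ , eq) = index-injective (level eq)
    where
      level : ∀ {k k′ s s′} → base (link (branch _) k s) ≡ base (link (branch _) k′ s′) → k ≡ k′
      level refl = refl

  data Image (B : SteinerQuasigroup) (e : Embedding B M) : Set where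
    inside-block    : ∀ i → (∀ y → ∃ λ a → Embedding.map (elem-embedding i) a ≡ Embedding.map e y) → Image B e
    inside-triangle : ∀ {U V} → U ≢ V
                      → (∀ y → ∃ λ t → Embedding.map e y ≡ Embeddings.Triangle.corner M U V t) → Image B e
    subsingleton    : (∀ (x y : Carrier B) → x ≡ y) → Image B e

  module Local (B : SteinerQuasigroup) (finB : Finite B) (e : Embedding B M) where

    open Embedding e

    P : Carrier B → Elem
    P y = proj₁ (map y)

    P-injective : ∀ {x y} → P x ≡ P y → x ≡ y
    P-injective eq = injective (Valid-≡ eq)

    P-hom : ∀ x y → P (_·_ B x y) ≡ P x ∙ P y
    P-hom x y = cong proj₁ (hom x y)

    Top : Carrier B → Set
    Top y₀ = ∀ y → rank ρ (P y) ≤ rank ρ (P y₀)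

    -- Around a top element, every element lies beneath it: neither P y nor P y₀ ∙ P y
    -- ranks above P y₀.
    around : ∀ {y₀} → Top y₀ → ∀ y → P y ≡ P y₀ ⊎ Under (P y₀) (P y)
    around {y₀} top y with P y ≟ P y₀
    ... | yes eq = inj₁ eq
    ... | no y≢y₀ = inj₂ (below-under (below-top ρ (λ eq → y≢y₀ (sym eq)) (top y)
                           (subst (λ w → rank ρ w ≤ rank ρ (P y₀)) (P-hom y₀ y) (top (_·_ B y₀ y)))))

    triangle : ∀ {y₀ u v} → parentsᴱ (P y₀) ≡ just (u , v)
      → (∀ y → P y ≡ u ⊎ P y ≡ v ⊎ P y ≡ P y₀) → Image B e
    triangle {y₀} par cover with parents-product (proj₂ (map y₀)) par
    ... | vu , vv , u≢v , uv = inside-triangle (λ eq → u≢v (cong proj₁ eq)) corner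
      where
        corner : ∀ y → ∃ λ t → map y ≡ Embeddings.Triangle.corner M (_ , vu) (_ , vv) t
        corner y with cover y
        ... | inj₁ eq        = Embeddings.c₀ , Valid-≡ eq
        ... | inj₂ (inj₁ eq) = Embeddings.c₁ , Valid-≡ eq
        ... | inj₂ (inj₂ eq) = Embeddings.c₂ , trans (Valid-≡ eq) (sym uv)

    outside-image : ∀ {y₀} → Top y₀ → (∀ i → ¬ InBlock i (P y₀)) → Image B e
    outside-image {y₀} top outside with parentsᴱ (P y₀) in par
    ... | just (u , v) = triangle par cover
      where
        cover : ∀ y → P y ≡ u ⊎ P y ≡ v ⊎ P y ≡ P y₀
        cover y with around top y
        ... | inj₁ eq = inj₂ (inj₂ eq)
        ... | inj₂ under with under-outside outside under
        ...   | _ , par′ , y∈ with trans (sym par) par′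
        ...     | refl = map₂ inj₁ y∈
    ... | nothing = subsingleton (λ x y → P-injective (trans (at-top x) (sym (at-top y))))
      where
        at-top : ∀ y → P y ≡ P y₀
        at-top y with around top y
        ... | inj₁ eq = eq
        ... | inj₂ under with under-outside outside under
        ...   | _ , par′ , _ with trans (sym par) par′
        ...     | ()

    -- A top element in block i: either the whole image lies in block i, or some element
    -- is a parent of P y₀; then no other element of block i occurs, since its parents
    -- would differ, and the image lies in the triangle of these parents.
    block-image : ∀ {y₀ i a} → Top y₀ → P y₀ ≡ base (elem i a) → Image B e
    block-image {y₀} {i} {a} top at with decide-all B finB (λ y → in-block? i (P y))
    ... | inj₁ all-in = inside-block i (λ y → proj₁ (all-in y) , Valid-≡ (sym (proj₂ (all-in y))))
    ... | inj₂ (y₁ , y₁-outside) = triangle (cong parentsᴱ at) cover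
      where
        beneath : ∀ {b y} → Top y → P y ≡ base (elem i b)
          → P y₁ ≡ base (link (branch i) (index b) s₀) ⊎ P y₁ ≡ base (link (branch i) (index b) s₂)
        beneath {b} {y} top-y at-y with around top-y y₁
        ... | inj₁ eq = ⊥-elim (y₁-outside (b , trans eq at-y))
        ... | inj₂ under with under-block (subst (λ w → Under w (P y₁)) at-y under)
        ...   | inj₁ in-i = ⊥-elim (y₁-outside in-i)
        ...   | inj₂ y₁∈ = y₁∈

        cover : ∀ y → P y ≡ base (link (branch i) (index a) s₀) ⊎ P y ≡ base (link (branch i) (index a) s₂) ⊎ P y ≡ P y₀
        cover y with around top y
        ... | inj₁ eq = inj₂ (inj₂ eq)
        ... | inj₂ under with under-block (subst (λ w → Under w (P y)) at under)
        ...   | inj₂ y∈ = map₂ inj₁ y∈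
        ...   | inj₁ (b , at-y) with b ≟ₐ a
        ...     | yes refl = inj₂ (inj₂ (trans at-y (sym at)))
        ...     | no b≢a = ⊥-elim (b≢a (attached-unique (attached (beneath top-y at-y)) (attached (beneath top at))))
          where
            top-y : Top y
            top-y y′ = subst (rank ρ (P y′) ≤_) (trans (cong (rank ρ) at) (sym (cong (rank ρ) at-y))) (top y′)

    image : Image B e
    image with maximum B finB (λ y → rank ρ (P y))
    ... | inj₁ empty = subsingleton (λ x → ⊥-elim (empty x))
    ... | inj₂ (y₀ , top) with in-some-block? (P y₀)
    ...   | inj₁ (i , a , at) = block-image top at
    ...   | inj₂ outside = outside-image top outside

  two-elements : ∀ i → 2 ≤ size i → Σ (Carrier (A i)) λ α → Σ (Carrier (A i)) λ β → α ≢ β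
  two-elements i 2≤size = element i 0 0<size , element i 1 2≤size , λ eq → 0≢1 (begin
      0                          ≡⟨ index-element i 0 0<size ⟨
      index (element i 0 0<size) ≡⟨ cong index eq ⟩
      index (element i 1 2≤size) ≡⟨ index-element i 1 2≤size ⟩
      1                          ∎)
    where
      open ≡-Reasoning
      0<size = ℕ.<-trans (s≤s z≤n) 2≤size
      0≢1 : 0 ≢ 1
      0≢1 ()


open Construction using (M; countably-infinite; three-generated; elem-embedding; two-elements;
                         inside-block; inside-triangle; subsingleton)
open Embeddings using (factor-embedding; triangle-embedding; subsingleton-embedding)

-- M is countable, three-generated and contains every A i; a finite substructure of M lies
-- in a copy of some A i, in a triangle, or in a single point, and the last two embed in any
-- A i₀ with at least two elements.
proposition3p1 : (A : ℕ → SteinerQuasigroup) → (fin : ∀ i → Finite (A i))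
    → (Σ ℕ λ i → 3 ≤ card (A i) (fin i))
    → Σ SteinerQuasigroup λ M →
        CountablyInfinite M
        × ThreeGenerated M
        × (∀ i → Embedding (A i) M)
        × ((B : SteinerQuasigroup) → Finite B → Embedding B M
             → Σ ℕ λ i → Embedding B (A i))
proposition3p1 A fin (i₀ , 3≤size) =
  M A fin , countably-infinite A fin , three-generated A fin , elem-embedding A fin , embeds-in-some-A
  where
    open import Data.Nat.Properties using (≤-trans; n≤1+n)

    distinct = two-elements A fin i₀ (≤-trans (n≤1+n 2) 3≤size)

    embeds-in-some-A : (B : SteinerQuasigroup) → Finite B → Embedding B (M A fin) → Σ ℕ λ i → Embedding B (A i)
    embeds-in-some-A B finB e with Construction.Local.image A fin B finB e
    ... | inside-block i preimage     = i , factor-embedding e (elem-embedding A fin i) preimage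
    ... | inside-triangle U≢V corners = i₀ , triangle-embedding e U≢V corners (proj₂ (proj₂ distinct))
    ... | subsingleton unique         = i₀ , subsingleton-embedding unique (proj₁ distinct)
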